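{- Let $\mathcal{M}=(E,r,m)$ be a ranked set with multiplicity over $R=\mathbb{R}$ and $p_e\in[0,1]$. Then $$\mathbb{E}\bigl[T_{\mathcal{M}|E_{\underline p}}(2,y)\bigr]=\mathbf{Z}_{\mathcal{M}}\bigl(y-1,(p_e(y-1))_{e\in E}\bigr).$$ In particular, if $p_e=p\in(0,1]$ for all $e$, $$\mathbb{E}\bigl[T_{\mathcal{M}|E_p}(2,y)\bigr]=p^{r(E)}\,T_{\mathcal{M}}\Bigl(1+\frac1p,\ 1+p(y-1)\Bigr).$$
   Context: A ranked set with multiplicity (rsm) is $\mathcal{N}=(E',r',m')$ with $E'$ finite, $r':2^{E'}\to\mathbb{Z}$ arbitrary, $m':2^{E'}\to R$ arbitrary. $\mathbf{Z}_{\mathcal{N}}(q,(v_e))=\sum_{A\subseteq E'}m'(A)q^{ -r'(A)}\prod_{e\in A}v_e$; $T_{\mathcal{N}}(x,y)=\sum_{A\subseteq E'}m'(A)(x-1)^{r'(E')-r'(A)}(y-1)^{|A|-r'(A)}$. Restriction $\mathcal{M}|A=(A,r|_{2^A},m|_{2^A})$ (so its Tutte polynomial uses $r(A)$ in place of $r(E)$). $E_{\underline p}$ is the random subset containing each $e$ independently with probability $p_e$; $E_p$ the case all $p_e=p$. -}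

module Defs where

open import Level using (Level)
open import Algebra.Bundles using (CommutativeRing)
open import Data.Nat using (ℕ; zero; suc)
open import Data.Integer using (ℤ; +_; -[1+_]) renaming (_-_ to _-ℤ_; -_ to -ℤ_)
open import Data.Fin using (Fin)
import Data.Fin as Fin
open import Data.Fin.Subset using (Subset; inside; outside; ⊤; ∣_∣)
open import Data.Vec using (Vec; []; _∷_)
open import Data.List using (List; []; _∷_; map; _++_)

record RSM {c ℓ : Level} (R : CommutativeRing c ℓ) (n : ℕ) : Set c where
  open CommutativeRing R
  field
    rank : Subset n → ℤ
    mult : Subset n → Carrier

-- All subsets A of E with A ⊆ S (each exactly once).
subsetsOf : ∀ {n} → Subset n → List (Subset n)
subsetsOf []              = [] ∷ []
subsetsOf (inside  ∷ S)   =
  map (inside ∷_) (subsetsOf S) ++ map (outside ∷_) (subsetsOf S)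
subsetsOf (outside ∷ S)   = map (outside ∷_) (subsetsOf S)

allSubsets : ∀ n → List (Subset n)
allSubsets n = subsetsOf (⊤ {n})

module _ {c ℓ : Level} (R : CommutativeRing c ℓ) where
  open CommutativeRing R

  sumL : List Carrier → Carrier
  sumL []       = 0#
  sumL (x ∷ xs) = x + sumL xs

  sumOver : ∀ {n} → List (Subset n) → (Subset n → Carrier) → Carrier
  sumOver As f = sumL (map f As)

  pow : Carrier → ℕ → Carrier
  pow a zero    = 1#
  pow a (suc k) = a * pow a k

  -- integer powers a^z of an invertible element a, given an inverse ainv of a
  zpow : Carrier → Carrier → ℤ → Carrier
  zpow a ainv (+ k)      = pow a k
  zpow a ainv -[1+ k ]   = pow ainv (suc k)

  prodIn : ∀ {n} → (Fin n → Carrier) → Subset n → Carrier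
  prodIn v []            = 1#
  prodIn v (inside  ∷ A) = v Fin.zero * prodIn (λ i → v (Fin.suc i)) A
  prodIn v (outside ∷ A) = prodIn (λ i → v (Fin.suc i)) A

  prodOut : ∀ {n} → (Fin n → Carrier) → Subset n → Carrier
  prodOut w []            = 1#
  prodOut w (inside  ∷ A) = prodOut (λ i → w (Fin.suc i)) A
  prodOut w (outside ∷ A) = w Fin.zero * prodOut (λ i → w (Fin.suc i)) A

  Zpart : ∀ {n} → RSM R n → (q qinv : Carrier) → (Fin n → Carrier) → Carrier
  Zpart {n} M q qinv v =
    sumOver (allSubsets n) λ A →
      mult A * zpow q qinv (-ℤ (rank A)) * prodIn v A
    where open RSM M

  -- Tutte polynomial of the restriction M|S (ground set S, rank and
  -- multiplicity restricted to subsets of S):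
  -- T_{M|S}(x,y) = Σ_{A ⊆ S} m(A) (x-1)^{r(S)-r(A)} (y-1)^{|A|-r(A)}.
  -- The arguments are x, an inverse xinv of (x - 1), y, an inverse yinv of (y - 1).
  TutteRestr : ∀ {n} → RSM R n → Subset n →
               (x xinv y yinv : Carrier) → Carrier
  TutteRestr M S x xinv y yinv =
    sumOver (subsetsOf S) λ A →
      mult A * zpow (x - 1#) xinv (rank S -ℤ rank A)
             * zpow (y - 1#) yinv ((+ ∣ A ∣) -ℤ rank A)
    where open RSM M

  Tutte : ∀ {n} → RSM R n → (x xinv y yinv : Carrier) → Carrier
  Tutte {n} M = TutteRestr M (⊤ {n})

  -- Expectation over the random subset E_p (each e included independently
  -- with probability p_e):  E[f(E_p)] = Σ_{S⊆E} Π_{e∈S} p_e Π_{e∉S} (1-p_e) f(S).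
  Expect : ∀ {n} → (Fin n → Carrier) → (Subset n → Carrier) → Carrier
  Expect {n} p f =
    sumOver (allSubsets n) λ S →
      prodIn p S * prodOut (λ e → 1# - p e) S * f S

module Submission where

-- Write Q = y - 1.  At x = 2 the factor (x-1)^{r(S)-r(A)} of T_{M|S}(x,y)
-- is 1, so T_{M|S}(2,y) = Σ_{A⊆S} h(A) with h(A) = m(A) Q^{|A|-r(A)}
-- no longer depends on S.  The probabilistic heart of the proof is the
-- identity  E[Σ_{A ⊆ E_p} h(A)] = Σ_A P(A ⊆ E_p) h(A) = Σ_A (Π_{e∈A} p_e) h(A),
-- proved by induction on the ground set, splitting on the first element.
-- Since Π_{e∈A} p_e · Q^{|A|} = Π_{e∈A} (p_e Q), the right-hand side is
-- exactly Z_M(Q, (p_e Q)_e), the first claim.  The second claim follows from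
-- the first and the general relation T_M(x,y) = (x-1)^{r(E)} Z_M((x-1)(y-1), y-1)
-- evaluated at x - 1 = 1/p, y - 1 = pQ.

open import Defs
open import Level using (Level)
open import Algebra.Bundles using (CommutativeRing)
open import Data.Nat using (ℕ; zero; suc)
open import Data.Fin using (Fin)
import Data.Fin as Fin
open import Data.Fin.Subset using (Subset; inside; outside; ⊤; ∣_∣)
open import Data.Vec using ([]; _∷_)
open import Data.List using (List; map; _++_)
import Data.List as List
open import Data.Product using (_×_; _,_)
open import Data.Integer using (ℤ; +_; -[1+_]) renaming (_+_ to _+ℤ_; -_ to -ℤ_)
import Data.Integer.Properties as ℤP
import Relation.Binary.PropositionalEquality as ≡
open ≡ using (_≡_)
import Algebra.Properties.CommutativeSemigroup as CommSemigroupProperties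

module RandomSubsets {c ℓ : Level} (R : CommutativeRing c ℓ) where
  open CommutativeRing R
  open import Relation.Binary.Reasoning.Setoid setoid
  open CommSemigroupProperties *-commutativeSemigroup
    using (x∙yz≈y∙xz) renaming (interchange to *-interchange)
  open CommSemigroupProperties +-commutativeSemigroup
    using () renaming (interchange to +-interchange)

  1+a-1≈a : ∀ a → (1# + a) - 1# ≈ a
  1+a-1≈a a = begin
    (1# + a) - 1#   ≈⟨ +-congʳ (+-comm 1# a) ⟩
    (a + 1#) - 1#   ≈⟨ +-assoc a 1# (- 1#) ⟩
    a + (1# - 1#)   ≈⟨ +-congˡ (-‿inverseʳ 1#) ⟩
    a + 0#          ≈⟨ +-identityʳ a ⟩
    a               ∎

  p+[1-p]≈1 : ∀ p → p + (1# - p) ≈ 1#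
  p+[1-p]≈1 p = begin
    p + (1# - p)    ≈⟨ +-congˡ (+-comm 1# (- p)) ⟩
    p + (- p + 1#)  ≈⟨ sym (+-assoc p (- p) 1#) ⟩
    (p - p) + 1#    ≈⟨ +-congʳ (-‿inverseʳ p) ⟩
    0# + 1#         ≈⟨ +-identityˡ 1# ⟩
    1#              ∎

  coin-flip : ∀ p a b → p * (a + b) + (1# - p) * b ≈ p * a + b
  coin-flip p a b = begin
    p * (a + b) + (1# - p) * b         ≈⟨ +-congʳ (distribˡ p a b) ⟩
    (p * a + p * b) + (1# - p) * b     ≈⟨ +-assoc _ _ _ ⟩
    p * a + (p * b + (1# - p) * b)     ≈⟨ +-congˡ (sym (distribʳ b p (1# - p))) ⟩
    p * a + (p + (1# - p)) * b         ≈⟨ +-congˡ (*-congʳ (p+[1-p]≈1 p)) ⟩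
    p * a + 1# * b                     ≈⟨ +-congˡ (*-identityˡ b) ⟩
    p * a + b                          ∎

  sumOver-++ : ∀ {n} (As Bs : List (Subset n)) f →
               sumOver R (As ++ Bs) f ≈ sumOver R As f + sumOver R Bs f
  sumOver-++ List.[]       Bs f = sym (+-identityˡ _)
  sumOver-++ (A List.∷ As) Bs f =
    trans (+-congˡ (sumOver-++ As Bs f)) (sym (+-assoc _ _ _))

  sumOver-map : ∀ {m n} (g : Subset m → Subset n) (As : List (Subset m)) f →
                sumOver R (map g As) f ≈ sumOver R As (λ A → f (g A))
  sumOver-map g List.[]       f = refl
  sumOver-map g (A List.∷ As) f = +-congˡ (sumOver-map g As f)

  sumOver-cong : ∀ {n} (As : List (Subset n)) {f g} → (∀ A → f A ≈ g A) →
                 sumOver R As f ≈ sumOver R As g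
  sumOver-cong List.[]       f≈g = refl
  sumOver-cong (A List.∷ As) f≈g = +-cong (f≈g A) (sumOver-cong As f≈g)

  sumOver-+ : ∀ {n} (As : List (Subset n)) f g →
              sumOver R As (λ A → f A + g A) ≈ sumOver R As f + sumOver R As g
  sumOver-+ List.[]       f g = sym (+-identityˡ _)
  sumOver-+ (A List.∷ As) f g =
    trans (+-congˡ (sumOver-+ As f g)) (+-interchange _ _ _ _)

  sumOver-*ˡ : ∀ {n} (As : List (Subset n)) k f →
               k * sumOver R As f ≈ sumOver R As (λ A → k * f A)
  sumOver-*ˡ List.[]       k f = zeroʳ k
  sumOver-*ˡ (A List.∷ As) k f =
    trans (distribˡ k _ _) (+-congˡ (sumOver-*ˡ As k f))

  sumOver-subsets-inside : ∀ {n} (S : Subset n) (g : Subset (suc n) → Carrier) →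
    sumOver R (subsetsOf (inside ∷ S)) g
      ≈ sumOver R (subsetsOf S) (λ A → g (inside ∷ A))
        + sumOver R (subsetsOf S) (λ A → g (outside ∷ A))
  sumOver-subsets-inside S g =
    trans (sumOver-++ (map (inside ∷_) (subsetsOf S)) _ g)
          (+-cong (sumOver-map _ (subsetsOf S) g) (sumOver-map _ (subsetsOf S) g))

  pow-cong : ∀ {a b} k → a ≈ b → pow R a k ≈ pow R b k
  pow-cong zero    a≈b = refl
  pow-cong (suc k) a≈b = *-cong a≈b (pow-cong k a≈b)

  pow-1 : ∀ k → pow R 1# k ≈ 1#
  pow-1 zero    = refl
  pow-1 (suc k) = trans (*-identityˡ _) (pow-1 k)

  pow-* : ∀ a b k → pow R (a * b) k ≈ pow R a k * pow R b k
  pow-* a b zero    = sym (*-identityˡ _)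
  pow-* a b (suc k) = trans (*-congˡ (pow-* a b k)) (*-interchange _ _ _ _)

  zpow-cong : ∀ {a a′ ai ai′} i → a ≈ a′ → ai ≈ ai′ →
              zpow R a ai i ≈ zpow R a′ ai′ i
  zpow-cong (+ k)    a≈a′ ai≈ai′ = pow-cong k a≈a′
  zpow-cong -[1+ k ] a≈a′ ai≈ai′ = pow-cong (suc k) ai≈ai′

  zpow-1 : ∀ i → zpow R 1# 1# i ≈ 1#
  zpow-1 (+ k)    = pow-1 k
  zpow-1 -[1+ k ] = pow-1 (suc k)

  zpow-* : ∀ a ai b bi i →
           zpow R (a * b) (ai * bi) i ≈ zpow R a ai i * zpow R b bi i
  zpow-* a ai b bi (+ k)    = pow-* a b k
  zpow-* a ai b bi -[1+ k ] = pow-* ai bi (suc k)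

  module IntegerPowers (a ai : Carrier) (a*ai≈1 : a * ai ≈ 1#) where

    private
      P : ℤ → Carrier
      P = zpow R a ai

      P-≡ : ∀ {i j} → i ≡ j → P i ≈ P j
      P-≡ ≡.refl = refl

      cancel : ∀ u v x → u * v ≈ 1# → u * (v * x) ≈ x
      cancel u v x uv≈1 =
        trans (sym (*-assoc _ _ _)) (trans (*-congʳ uv≈1) (*-identityˡ x))

      zpow-1+ : ∀ i → P (+ 1 +ℤ i) ≈ a * P i
      zpow-1+ (+ k)          = refl
      zpow-1+ -[1+ zero ]    = sym (trans (*-congˡ (*-identityʳ ai)) a*ai≈1)
      zpow-1+ -[1+ suc k ]   = sym (cancel a ai _ a*ai≈1)

      zpow-pred : ∀ i → P (-[1+ 0 ] +ℤ i) ≈ ai * P i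
      zpow-pred -[1+ k ]   = refl
      zpow-pred (+ zero)   = refl
      zpow-pred (+ suc k)  = sym (cancel ai a _ (trans (*-comm ai a) a*ai≈1))

    zpow-+ : ∀ i j → P (i +ℤ j) ≈ P i * P j
    zpow-+ (+ zero) j =
      trans (P-≡ (ℤP.+-identityˡ j)) (sym (*-identityˡ _))
    zpow-+ (+ suc k) j = begin
      P (+ suc k +ℤ j)             ≈⟨ P-≡ (ℤP.+-assoc (+ 1) (+ k) j) ⟩
      P (+ 1 +ℤ (+ k +ℤ j))        ≈⟨ zpow-1+ (+ k +ℤ j) ⟩
      a * P (+ k +ℤ j)             ≈⟨ *-congˡ (zpow-+ (+ k) j) ⟩
      a * (P (+ k) * P j)          ≈⟨ sym (*-assoc _ _ _) ⟩
      P (+ suc k) * P j            ∎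
    zpow-+ -[1+ zero ] j =
      trans (zpow-pred j) (*-congʳ (sym (*-identityʳ ai)))
    zpow-+ -[1+ suc k ] j = begin
      P (-[1+ suc k ] +ℤ j)            ≈⟨ P-≡ (ℤP.+-assoc -[1+ 0 ] -[1+ k ] j) ⟩
      P (-[1+ 0 ] +ℤ (-[1+ k ] +ℤ j))  ≈⟨ zpow-pred (-[1+ k ] +ℤ j) ⟩
      ai * P (-[1+ k ] +ℤ j)           ≈⟨ *-congˡ (zpow-+ -[1+ k ] j) ⟩
      ai * (P -[1+ k ] * P j)          ≈⟨ sym (*-assoc _ _ _) ⟩
      P -[1+ suc k ] * P j             ∎

  prodIn-cong : ∀ {n} {v w : Fin n → Carrier} → (∀ e → v e ≈ w e) →
                ∀ A → prodIn R v A ≈ prodIn R w A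
  prodIn-cong v≈w []            = refl
  prodIn-cong v≈w (inside ∷ A)  =
    *-cong (v≈w Fin.zero) (prodIn-cong (λ e → v≈w (Fin.suc e)) A)
  prodIn-cong v≈w (outside ∷ A) = prodIn-cong (λ e → v≈w (Fin.suc e)) A

  prodIn-scale : ∀ {n} (v : Fin n → Carrier) k A →
                 prodIn R (λ e → v e * k) A ≈ prodIn R v A * pow R k ∣ A ∣
  prodIn-scale v k []            = sym (*-identityˡ _)
  prodIn-scale v k (inside ∷ A)  =
    trans (*-congˡ (prodIn-scale (λ e → v (Fin.suc e)) k A)) (*-interchange _ _ _ _)
  prodIn-scale v k (outside ∷ A) = prodIn-scale (λ e → v (Fin.suc e)) k A

  prodIn-const : ∀ {n} k (A : Subset n) → prodIn R (λ _ → k) A ≈ pow R k ∣ A ∣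
  prodIn-const k []            = refl
  prodIn-const k (inside ∷ A)  = *-congˡ (prodIn-const k A)
  prodIn-const k (outside ∷ A) = prodIn-const k A

  Expect-cong : ∀ {n} (p : Fin n → Carrier) {f g} → (∀ S → f S ≈ g S) →
                Expect R p f ≈ Expect R p g
  Expect-cong {n} p f≈g = sumOver-cong (allSubsets n) (λ S → *-congˡ (f≈g S))

  Expect-+ : ∀ {n} (p : Fin n → Carrier) f g →
             Expect R p (λ S → f S + g S) ≈ Expect R p f + Expect R p g
  Expect-+ {n} p f g =
    trans (sumOver-cong (allSubsets n) (λ S → distribˡ _ (f S) (g S)))
          (sumOver-+ (allSubsets n) _ _)

  Expect-step : ∀ {n} (p : Fin (suc n) → Carrier) (f : Subset (suc n) → Carrier) →
    Expect R p f
      ≈ p Fin.zero * Expect R (λ e → p (Fin.suc e)) (λ S → f (inside ∷ S))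
        + (1# - p Fin.zero) * Expect R (λ e → p (Fin.suc e)) (λ S → f (outside ∷ S))
  Expect-step {n} p f = begin
    Expect R p f
      ≈⟨ sumOver-subsets-inside (⊤ {n}) (λ S → prodIn R p S * prodOut R (λ e → 1# - p e) S * f S) ⟩
    sumOver R Ls (λ S → p₀ * Πin S * Πout S * f (inside ∷ S))
      + sumOver R Ls (λ S → Πin S * (q₀ * Πout S) * f (outside ∷ S))
      ≈⟨ +-cong (sumOver-cong Ls (λ S → trans (*-congʳ (*-assoc p₀ _ _)) (*-assoc p₀ _ _)))
                (sumOver-cong Ls (λ S → trans (*-congʳ (x∙yz≈y∙xz _ q₀ _)) (*-assoc q₀ _ _))) ⟩
    sumOver R Ls (λ S → p₀ * (Πin S * Πout S * f (inside ∷ S)))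
      + sumOver R Ls (λ S → q₀ * (Πin S * Πout S * f (outside ∷ S)))
      ≈⟨ sym (+-cong (sumOver-*ˡ Ls p₀ _) (sumOver-*ˡ Ls q₀ _)) ⟩
    p₀ * Expect R p′ (λ S → f (inside ∷ S)) + q₀ * Expect R p′ (λ S → f (outside ∷ S)) ∎
    where
    Ls = allSubsets n
    p₀ = p Fin.zero
    q₀ = 1# - p₀
    p′ : Fin n → Carrier
    p′ e = p (Fin.suc e)
    Πin Πout : Subset n → Carrier
    Πin  = prodIn R p′
    Πout = prodOut R (λ e → 1# - p′ e)

  Expect-sumSubsets : ∀ n (p : Fin n → Carrier) (h : Subset n → Carrier) →
    Expect R p (λ S → sumOver R (subsetsOf S) h)
      ≈ sumOver R (allSubsets n) (λ A → prodIn R p A * h A)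
  Expect-sumSubsets zero p h =
    +-congʳ (*-cong (*-identityʳ 1#) (+-identityʳ (h [])))
  Expect-sumSubsets (suc n) p h = begin
    Expect R p (λ S → sumOver R (subsetsOf S) h)
      ≈⟨ Expect-step p _ ⟩
    p₀ * Expect R p′ (λ S → sumOver R (subsetsOf (inside ∷ S)) h)
      + q₀ * Expect R p′ (λ S → sumOver R (subsetsOf (outside ∷ S)) h)
      ≈⟨ +-cong (*-congˡ (trans (Expect-cong p′ (λ S → sumOver-subsets-inside S h))
                                (Expect-+ p′ _ _)))
                (*-congˡ (Expect-cong p′ (λ S → sumOver-map _ (subsetsOf S) h))) ⟩
    p₀ * (Expect R p′ (Σ h₁) + Expect R p′ (Σ h₀)) + q₀ * Expect R p′ (Σ h₀)
      ≈⟨ coin-flip p₀ _ _ ⟩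
    p₀ * Expect R p′ (Σ h₁) + Expect R p′ (Σ h₀)
      ≈⟨ +-cong (*-congˡ (Expect-sumSubsets n p′ h₁)) (Expect-sumSubsets n p′ h₀) ⟩
    p₀ * sumOver R Ls (λ A → prodIn R p′ A * h₁ A) + sumOver R Ls (λ A → prodIn R p′ A * h₀ A)
      ≈⟨ +-congʳ (trans (sumOver-*ˡ Ls p₀ _) (sumOver-cong Ls (λ A → sym (*-assoc _ _ _)))) ⟩
    sumOver R Ls (λ A → prodIn R p (inside ∷ A) * h₁ A)
      + sumOver R Ls (λ A → prodIn R p (outside ∷ A) * h₀ A)
      ≈⟨ sym (sumOver-subsets-inside (⊤ {n}) (λ A → prodIn R p A * h A)) ⟩
    sumOver R (allSubsets (suc n)) (λ A → prodIn R p A * h A) ∎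
    where
    Ls = allSubsets n
    p₀ = p Fin.zero
    q₀ = 1# - p₀
    p′ : Fin n → Carrier
    p′ e = p (Fin.suc e)
    h₁ h₀ : Subset n → Carrier
    h₁ A = h (inside ∷ A)
    h₀ A = h (outside ∷ A)
    Σ : (Subset n → Carrier) → Subset n → Carrier
    Σ g S = sumOver R (subsetsOf S) g

  module _ {n : ℕ} (M : RSM R n) where
    open RSM M

    Zpart-cong : ∀ {q q′ qinv qinv′} {v v′ : Fin n → Carrier} →
      q ≈ q′ → qinv ≈ qinv′ → (∀ e → v e ≈ v′ e) →
      Zpart R M q qinv v ≈ Zpart R M q′ qinv′ v′
    Zpart-cong q≈q′ qinv≈qinv′ v≈v′ = sumOver-cong (allSubsets n) λ A →
      *-cong (*-congˡ (zpow-cong (-ℤ rank A) q≈q′ qinv≈qinv′)) (prodIn-cong v≈v′ A)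

    -- At x = 2 the rank of the ground set drops out:
    -- T_{M|S}(2,y) = Σ_{A⊆S} m(A) (y-1)^{|A|-r(A)}.
    TutteRestr-at-2 : ∀ S y yinv →
      TutteRestr R M S (1# + 1#) 1# y yinv
        ≈ sumOver R (subsetsOf S) (λ A → mult A * zpow R (y - 1#) yinv (+ ∣ A ∣ +ℤ -ℤ rank A))
    TutteRestr-at-2 S y yinv = sumOver-cong (subsetsOf S) λ A →
      let d = rank S +ℤ -ℤ rank A in
      *-congʳ (trans (*-congˡ (trans (zpow-cong d (1+a-1≈a 1#) refl) (zpow-1 d)))
                     (*-identityʳ _))

    Tutte≈Zpart : ∀ x xinv y yinv → (x - 1#) * xinv ≈ 1# → (y - 1#) * yinv ≈ 1# →
      Tutte R M x xinv y yinv
        ≈ zpow R (x - 1#) xinv (rank ⊤)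
          * Zpart R M ((x - 1#) * (y - 1#)) (xinv * yinv) (λ _ → y - 1#)
    Tutte≈Zpart x xinv y yinv xinv-ok yinv-ok =
      trans (sumOver-cong (allSubsets n) term)
            (sym (sumOver-*ˡ (allSubsets n) (X (rank ⊤)) _))
      where
      X Y : ℤ → Carrier
      X = zpow R (x - 1#) xinv
      Y = zpow R (y - 1#) yinv
      module XP = IntegerPowers (x - 1#) xinv xinv-ok
      module YP = IntegerPowers (y - 1#) yinv yinv-ok
      term : ∀ A →
        mult A * X (rank ⊤ +ℤ -ℤ rank A) * Y (+ ∣ A ∣ +ℤ -ℤ rank A)
          ≈ X (rank ⊤) * (mult A * zpow R ((x - 1#) * (y - 1#)) (xinv * yinv) (-ℤ rank A)
                         * prodIn R (λ _ → y - 1#) A)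
      term A = begin
        mult A * X (rank ⊤ +ℤ -ℤ r) * Y (+ ∣ A ∣ +ℤ -ℤ r)
          ≈⟨ *-cong (*-congˡ (XP.zpow-+ (rank ⊤) (-ℤ r))) (YP.zpow-+ (+ ∣ A ∣) (-ℤ r)) ⟩
        mult A * (X (rank ⊤) * X (-ℤ r)) * (Y (+ ∣ A ∣) * Y (-ℤ r))
          ≈⟨ *-congʳ (x∙yz≈y∙xz _ _ _) ⟩
        X (rank ⊤) * (mult A * X (-ℤ r)) * (Y (+ ∣ A ∣) * Y (-ℤ r))
          ≈⟨ *-assoc _ _ _ ⟩
        X (rank ⊤) * (mult A * X (-ℤ r) * (Y (+ ∣ A ∣) * Y (-ℤ r)))
          ≈⟨ *-congˡ (trans (*-congˡ (*-comm _ _)) (*-interchange _ _ _ _)) ⟩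
        X (rank ⊤) * (mult A * Y (-ℤ r) * (X (-ℤ r) * Y (+ ∣ A ∣)))
          ≈⟨ *-congˡ (trans (sym (*-assoc _ _ _)) (*-congʳ (*-assoc _ _ _))) ⟩
        X (rank ⊤) * (mult A * (Y (-ℤ r) * X (-ℤ r)) * Y (+ ∣ A ∣))
          ≈⟨ *-congˡ (*-cong (*-congˡ (trans (*-comm _ _) (sym (zpow-* _ _ _ _ (-ℤ r)))))
                             (sym (prodIn-const (y - 1#) A))) ⟩
        X (rank ⊤) * (mult A * zpow R ((x - 1#) * (y - 1#)) (xinv * yinv) (-ℤ r)
                     * prodIn R (λ _ → y - 1#) A) ∎
        where r = rank A

    expected-Tutte-at-2 : ∀ y yinv → (y - 1#) * yinv ≈ 1# → (p : Fin n → Carrier) →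
      Expect R p (λ S → TutteRestr R M S (1# + 1#) 1# y yinv)
        ≈ Zpart R M (y - 1#) yinv (λ e → p e * (y - 1#))
    expected-Tutte-at-2 y yinv yinv-ok p = begin
      Expect R p (λ S → TutteRestr R M S (1# + 1#) 1# y yinv)
        ≈⟨ Expect-cong p (λ S → TutteRestr-at-2 S y yinv) ⟩
      Expect R p (λ S → sumOver R (subsetsOf S) h)
        ≈⟨ Expect-sumSubsets n p h ⟩
      sumOver R (allSubsets n) (λ A → prodIn R p A * h A)
        ≈⟨ sym (sumOver-cong (allSubsets n) term) ⟩
      Zpart R M (y - 1#) yinv (λ e → p e * (y - 1#)) ∎
      where
      Q : ℤ → Carrier
      Q = zpow R (y - 1#) yinv
      module QP = IntegerPowers (y - 1#) yinv yinv-ok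
      h : Subset n → Carrier
      h A = mult A * Q (+ ∣ A ∣ +ℤ -ℤ rank A)
      term : ∀ A → mult A * Q (-ℤ rank A) * prodIn R (λ e → p e * (y - 1#)) A
                   ≈ prodIn R p A * h A
      term A = begin
        mult A * Q (-ℤ rank A) * prodIn R (λ e → p e * (y - 1#)) A
          ≈⟨ *-congˡ (prodIn-scale p (y - 1#) A) ⟩
        mult A * Q (-ℤ rank A) * (prodIn R p A * Q (+ ∣ A ∣))
          ≈⟨ trans (*-assoc _ _ _) (trans (*-congˡ (x∙yz≈y∙xz _ _ _)) (x∙yz≈y∙xz _ _ _)) ⟩
        prodIn R p A * (mult A * (Q (-ℤ rank A) * Q (+ ∣ A ∣)))
          ≈⟨ *-congˡ (*-congˡ (trans (*-comm _ _) (sym (QP.zpow-+ (+ ∣ A ∣) (-ℤ rank A))))) ⟩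
        prodIn R p A * h A ∎

    -- With x - 1 = 1/p and
    -- Y - 1 = p(y-1) one has (x-1)(Y-1) = y - 1, so by the first claim and
    -- Tutte≈Zpart the factor p^{r(E)} cancels (x-1)^{r(E)}.
    expected-Tutte-uniform : ∀ y yinv → (y - 1#) * yinv ≈ 1# →
      (p pinv : Carrier) → p * pinv ≈ 1# →
      Expect R (λ _ → p) (λ S → TutteRestr R M S (1# + 1#) 1# y yinv)
        ≈ zpow R p pinv (rank ⊤)
          * Tutte R M (1# + pinv) p (1# + p * (y - 1#)) (pinv * yinv)
    expected-Tutte-uniform y yinv yinv-ok p pinv pinv-ok = begin
      Expect R (λ _ → p) (λ S → TutteRestr R M S (1# + 1#) 1# y yinv)
        ≈⟨ expected-Tutte-at-2 y yinv yinv-ok (λ _ → p) ⟩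
      Zpart R M (y - 1#) yinv (λ _ → p * (y - 1#))
        ≈⟨ sym (Zpart-cong q≈y-1 qinv≈yinv (λ _ → 1+a-1≈a (p * (y - 1#)))) ⟩
      Zpart R M (x-1 * Y-1) (p * (pinv * yinv)) (λ _ → Y-1)
        ≈⟨ sym (trans (*-congʳ cancel-rank) (*-identityˡ _)) ⟩
      (P rE * zpow R x-1 p rE) * Zpart R M (x-1 * Y-1) (p * (pinv * yinv)) (λ _ → Y-1)
        ≈⟨ *-assoc _ _ _ ⟩
      P rE * (zpow R x-1 p rE * Zpart R M (x-1 * Y-1) (p * (pinv * yinv)) (λ _ → Y-1))
        ≈⟨ *-congˡ (sym (Tutte≈Zpart (1# + pinv) p (1# + p * (y - 1#)) (pinv * yinv) x-inv Y-inv)) ⟩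
      P rE * Tutte R M (1# + pinv) p (1# + p * (y - 1#)) (pinv * yinv) ∎
      where
      rE = rank ⊤
      P = zpow R p pinv
      x-1 = (1# + pinv) - 1#
      Y-1 = (1# + p * (y - 1#)) - 1#
      pinv*[p*a]≈a : ∀ a → pinv * (p * a) ≈ a
      pinv*[p*a]≈a a = trans (sym (*-assoc _ _ _))
        (trans (*-congʳ (trans (*-comm pinv p) pinv-ok)) (*-identityˡ a))
      qinv≈yinv : p * (pinv * yinv) ≈ yinv
      qinv≈yinv = trans (sym (*-assoc _ _ _)) (trans (*-congʳ pinv-ok) (*-identityˡ yinv))
      q≈y-1 : x-1 * Y-1 ≈ y - 1#
      q≈y-1 = trans (*-cong (1+a-1≈a pinv) (1+a-1≈a _)) (pinv*[p*a]≈a (y - 1#))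
      x-inv : x-1 * p ≈ 1#
      x-inv = trans (*-congʳ (1+a-1≈a pinv)) (trans (*-comm pinv p) pinv-ok)
      Y-inv : Y-1 * (pinv * yinv) ≈ 1#
      Y-inv = trans (*-congʳ (1+a-1≈a _)) (trans (*-interchange _ _ _ _)
                (trans (*-congʳ pinv-ok) (trans (*-identityˡ _) yinv-ok)))
      cancel-rank : P rE * zpow R x-1 p rE ≈ 1#
      cancel-rank = begin
        P rE * zpow R x-1 p rE              ≈⟨ *-congˡ (zpow-cong rE (1+a-1≈a pinv) refl) ⟩
        P rE * zpow R pinv p rE             ≈⟨ sym (zpow-* p pinv pinv p rE) ⟩
        zpow R (p * pinv) (pinv * p) rE     ≈⟨ zpow-cong rE pinv-ok (trans (*-comm pinv p) pinv-ok) ⟩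
        zpow R 1# 1# rE                     ≈⟨ zpow-1 rE ⟩
        1#                                  ∎

corollary4p2 : ∀ {c ℓ : Level} (R : CommutativeRing c ℓ) (n : ℕ) (M : RSM R n) →
    let open CommutativeRing R in
    (y yinv : Carrier) → (y - 1#) * yinv ≈ 1# →
    ((p : Fin n → Carrier) →
       Expect R p (λ S → TutteRestr R M S (1# + 1#) 1# y yinv)
         ≈ Zpart R M (y - 1#) yinv (λ e → p e * (y - 1#)))
    ×
    ((p pinv : Carrier) → p * pinv ≈ 1# →
       Expect R (λ _ → p) (λ S → TutteRestr R M S (1# + 1#) 1# y yinv)
         ≈ zpow R p pinv (RSM.rank M (⊤ {n}))
           * Tutte R M (1# + pinv) p (1# + p * (y - 1#)) (pinv * yinv))
corollary4p2 R n M y yinv yinv-ok =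
  expected-Tutte-at-2 M y yinv yinv-ok , expected-Tutte-uniform M y yinv yinv-ok
  where open RandomSubsets R
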